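{- Let $S$ be a numerical semigroup with minimal generators $a_1<a_2<\cdots<a_\nu$ (so $\nu\ge 2$), multiplicity $\mu=a_1$ and conductor $c$, and suppose $a_2>\frac{c+\mu}{3}$. Let $P=\{a_1,\ldots,a_\nu\}$, $P_1=\{a\in P\setminus\{\mu\}\mid \frac{c+\mu}{3}<a<\frac{c+\mu}{2}\}$, $P_2=\{a\in P\setminus\{\mu\}\mid \frac{c+\mu}{2}\le a<\frac{2}{3}(c+\mu)\}$. Let $\pi:\mathbb{Z}\to\mathbb{Z}/\mu\mathbb{Z}$ be the canonical projection and $A=\pi(P)$, $A_1=\pi(P_1)$, $A_2=\pi(P_2)$. Then $$\mathbb{Z}/\mu\mathbb{Z}=A\cup(A_1+A_1)\cup(A_1+A_2).$$
   Context: A numerical semigroup is a subset $S\subseteq\mathbb{N}$ containing $0$, closed under addition, with $\mathbb{N}\setminus S$ finite. Its conductor $c=c(S)$ is the least integer $x$ with $x+\mathbb{N}\subseteq S$. $S$ has a unique minimal set of generators; its cardinality is the embedding dimension $\nu(S)$ and its least element is the multiplicity $\mu(S)$. For $X,Y\subseteq\mathbb{Z}/\mu\mathbb{Z}$, the sumset is $X+Y=\{x+y\mid x\in X,y\in Y\}$. -}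

module Defs where

open import Data.Nat using (ℕ; zero; suc; _+_; _*_; _≤_; _<_)
open import Data.Bool using (Bool; true; false)
open import Data.Product using (Σ; ∃; ∃-syntax; _×_; _,_)
open import Data.Sum using (_⊎_)
open import Relation.Nullary using (¬_)
open import Relation.Binary.PropositionalEquality using (_≡_; _≢_)

_∈_ : ℕ → (ℕ → Bool) → Set
x ∈ S = S x ≡ true

record IsNumericalSemigroup (S : ℕ → Bool) : Set where
  field
    zero∈  : 0 ∈ S
    +-closed : ∀ x y → x ∈ S → y ∈ S → (x + y) ∈ S
    cofinite : ∃[ N ] (∀ x → N ≤ x → x ∈ S)

IsConductor : (ℕ → Bool) → ℕ → Set
IsConductor S c =
  (∀ x → c ≤ x → x ∈ S) ×
  (∀ d → (∀ x → d ≤ x → x ∈ S) → c ≤ d)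

IsMinimalGenerator : (ℕ → Bool) → ℕ → Set
IsMinimalGenerator S a =
  a ∈ S × a ≢ 0 ×
  ¬ (∃[ x ] ∃[ y ] (x ∈ S × y ∈ S × x ≢ 0 × y ≢ 0 × x + y ≡ a))

IsMultiplicity : (ℕ → Bool) → ℕ → Set
IsMultiplicity S μ = μ ∈ S × μ ≢ 0 × (∀ x → x ∈ S → x ≢ 0 → μ ≤ x)

CongMod : ℕ → ℕ → ℕ → Set
CongMod m x y = ∃[ k ] (x ≡ y + k * m ⊎ y ≡ x + k * m)

InP₁ : (ℕ → Bool) → ℕ → ℕ → ℕ → Set
InP₁ S μ c a = IsMinimalGenerator S a × a ≢ μ × c + μ < 3 * a × 2 * a < c + μ

InP₂ : (ℕ → Bool) → ℕ → ℕ → ℕ → Set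
InP₂ S μ c a = IsMinimalGenerator S a × a ≢ μ × c + μ ≤ 2 * a × 3 * a < 2 * (c + μ)

module Submission where

-- Write L = c + μ.  The argument runs through the Apéry set of
-- S with respect to μ: the elements w ∈ S with w - μ ∉ S.
--   * Every residue class modulo μ contains an Apéry element (descend by μ
--     from a large member of the class), and Apéry elements are < L, since
--     otherwise w - μ ≥ c would lie in S.
--   * Summands of an Apéry element are Apéry elements, and an Apéry element
--     is never μ.  Hence, decomposing into minimal generators, every nonzero
--     Apéry element is at least a₂, the least generator other than μ.
--   * Let w be the Apéry element of the class of x.  If w = 0 the class is
--     that of the generator μ; if w is a minimal generator we are done.
--     Otherwise w = a + b with 0 < a ≤ b in S; both are Apéry elements, so
--     a, b ≥ a₂ > L/3, and since a + b < L neither can split further: both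
--     are minimal generators.  The bounds L/3 < a ≤ b and a + b < L then
--     place a in P₁ and b in P₁ or P₂.

open import Defs
open import Data.Nat using (ℕ; zero; suc; _+_; _*_; _∸_; _≤_; _<_; _≟_; _≤?_; >-nonZero)
open import Data.Nat.Properties
open import Data.Nat.Induction using (<-rec)
open import Data.Nat.Solver using (module +-*-Solver)
open import Data.Bool using (Bool; true)
open import Data.Bool.Properties using () renaming (_≟_ to _≟ᵇ_)
open import Data.Product using (∃-syntax; _×_; _,_; proj₁)
open import Data.Sum using (_⊎_; inj₁; inj₂)
open import Relation.Nullary using (¬_; Dec; yes; no)
open import Relation.Nullary.Decidable using (_×-dec_; ¬?)
open import Relation.Binary.PropositionalEquality

open +-*-Solver using (solve; _:+_; _:*_; _:=_; con)

_∈?_ : (n : ℕ) (S : ℕ → Bool) → Dec (n ∈ S)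
n ∈? S = S n ≟ᵇ true

Decomposable : (ℕ → Bool) → ℕ → Set
Decomposable S w = ∃[ x ] ∃[ y ] (x ∈ S × y ∈ S × x ≢ 0 × y ≢ 0 × x + y ≡ w)

-- Decomposability is decidable: the first summand ranges over y < w.
decomposable? : (S : ℕ → Bool) (w : ℕ) → Dec (Decomposable S w)
decomposable? S w with anyUpTo? (λ y → y ∈? S ×-dec (w ∸ y) ∈? S ×-dec ¬? (y ≟ 0) ×-dec ¬? (w ∸ y ≟ 0)) w
... | yes (y , y<w , y∈ , r∈ , y≢0 , r≢0) =
  yes (y , w ∸ y , y∈ , r∈ , y≢0 , r≢0 , m+[n∸m]≡n (<⇒≤ y<w))
... | no none = no λ { (y , z , y∈ , z∈ , y≢0 , z≢0 , refl) →
  none (y , m<m+n y (n≢0⇒n>0 z≢0) , y∈ , subst (_∈ S) (sym (m+n∸m≡n y z)) z∈ ,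
        y≢0 , (λ r≡0 → z≢0 (trans (sym (m+n∸m≡n y z)) r≡0))) }

generator-or-decomposable : ∀ {S w} → w ∈ S → w ≢ 0 → IsMinimalGenerator S w ⊎ Decomposable S w
generator-or-decomposable {S} {w} w∈ w≢0 with decomposable? S w
... | yes dec = inj₂ dec
... | no ¬dec = inj₁ (w∈ , w≢0 , ¬dec)

multiplicity-generator : ∀ {S μ} → IsMultiplicity S μ → IsMinimalGenerator S μ
multiplicity-generator (μ∈ , μ≢0 , least) = μ∈ , μ≢0 ,
  λ { (p , q , p∈ , q∈ , p≢0 , q≢0 , p+q≡μ) →
      <⇒≱ (m<m+n p (n≢0⇒n>0 q≢0)) (subst (_≤ p) (sym p+q≡μ) (least p p∈ p≢0)) }

congMod-shift : ∀ {m x t} → CongMod m x t → CongMod m x (m + t)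
congMod-shift {m} {x} {t} (zero , inj₁ x≡t) = 1 , inj₂ (begin
  m + t      ≡⟨ +-comm m t ⟩
  t + m      ≡⟨ cong₂ _+_ (trans (sym (+-identityʳ t)) (sym x≡t)) (sym (+-identityʳ m)) ⟩
  x + 1 * m  ∎)
  where open ≡-Reasoning
congMod-shift {m} {t = t} (suc k , inj₁ e) = k , inj₁ (trans e
  (solve 3 (λ m t k → t :+ (m :+ k :* m) := (m :+ t) :+ k :* m) refl m t k))
congMod-shift {m} {x} (k , inj₂ e) = suc k , inj₂ (trans (cong (m +_) e)
  (solve 3 (λ m x k → m :+ (x :+ k :* m) := x :+ (m :+ k :* m)) refl m x k))

congMod-unshift : ∀ {m x t} → CongMod m x (m + t) → CongMod m x t
congMod-unshift {m} {t = t} (k , inj₁ e) = suc k , inj₁ (trans e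
  (solve 3 (λ m t k → (m :+ t) :+ k :* m := t :+ (m :+ k :* m)) refl m t k))
congMod-unshift {m} {x} {t} (zero , inj₂ e) = 1 , inj₁ (begin
  x          ≡⟨ sym (+-identityʳ x) ⟩
  x + 0      ≡⟨ sym e ⟩
  m + t      ≡⟨ solve 2 (λ m t → m :+ t := t :+ (m :+ con 0)) refl m t ⟩
  t + 1 * m  ∎)
  where open ≡-Reasoning
congMod-unshift {m} {x} {t} (suc k , inj₂ e) = k , inj₂ (+-cancelˡ-≡ m t (x + k * m) (trans e
  (solve 3 (λ m x k → x :+ (m :+ k :* m) := m :+ (x :+ k :* m)) refl m x k)))

Shifted : (ℕ → Bool) → ℕ → ℕ → Set
Shifted S m w = ∃[ t ] (t ∈ S × w ≡ m + t)

shifted? : (S : ℕ → Bool) (m w : ℕ) → Dec (Shifted S m w)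
shifted? S m w with m ≤? w
... | no m≰w = no λ { (t , _ , refl) → m≰w (m≤m+n m t) }
... | yes m≤w with (w ∸ m) ∈? S
...   | yes t∈ = yes (w ∸ m , t∈ , sym (m+[n∸m]≡n m≤w))
...   | no t∉ = no λ { (t , t∈ , refl) → t∉ (subst (_∈ S) (sym (m+n∸m≡n m t)) t∈) }

InApery : (ℕ → Bool) → ℕ → ℕ → Set
InApery S m w = w ∈ S × ¬ Shifted S m w

-- Apéry elements lie below c + m: from c + m ≤ w we would get w - m ∈ S.
apery-below-conductor : ∀ {S m c w} → IsConductor S c → InApery S m w → w < c + m
apery-below-conductor {m = m} {c} {w} (beyond , _) (_ , unshifted) = ≰⇒> λ c+m≤w →
  unshifted (w ∸ m , beyond (w ∸ m) (m+n≤o⇒m≤o∸n c c+m≤w) ,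
             sym (m+[n∸m]≡n (m+n≤o⇒n≤o c c+m≤w)))

module ApérySet {S : ℕ → Bool} (NS : IsNumericalSemigroup S) where
  open IsNumericalSemigroup NS

  apery-summandˡ : ∀ {m p q} → p ∈ S → q ∈ S → InApery S m (p + q) → InApery S m p
  apery-summandˡ {m} {q = q} p∈ q∈ (_ , unshifted) = p∈ , λ { (t , t∈ , refl) →
    unshifted (t + q , +-closed t q t∈ q∈ , +-assoc m t q) }

  apery-summandʳ : ∀ {m p q} → p ∈ S → q ∈ S → InApery S m (p + q) → InApery S m q
  apery-summandʳ {p = p} {q} p∈ q∈ ap =
    apery-summandˡ q∈ p∈ (subst (InApery S _) (+-comm p q) ap)

  apery-≢ : ∀ {m w} → InApery S m w → w ≢ m
  apery-≢ {m} (_ , unshifted) refl = unshifted (0 , zero∈ , sym (+-identityʳ m))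

  apery-lower-bound : ∀ {m b} → (∀ a → IsMinimalGenerator S a → a ≢ m → b ≤ a) →
    ∀ w → InApery S m w → w ≢ 0 → b ≤ w
  apery-lower-bound {m} {b} generators-above = <-rec Bound step
    where
    Bound : ℕ → Set
    Bound w = InApery S m w → w ≢ 0 → b ≤ w

    step : ∀ w → (∀ {v} → v < w → Bound v) → Bound w
    step w ih ap w≢0 with generator-or-decomposable (proj₁ ap) w≢0
    ... | inj₁ gen = generators-above w gen (apery-≢ ap)
    ... | inj₂ (p , q , p∈ , q∈ , p≢0 , q≢0 , refl) =
      ≤-trans (ih (m<m+n p (n≢0⇒n>0 q≢0)) (apery-summandˡ p∈ q∈ ap) p≢0) (m≤m+n p q)

  -- Each residue class modulo m > 0 meets the Apéry set: start from the
  -- member x + N·m of S (N beyond all gaps) and subtract m while staying in S.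
  apery-representative : ∀ {m} → 0 < m → (x : ℕ) → ∃[ w ] (InApery S m w × CongMod m x w)
  apery-representative {m} 0<m x with cofinite
  ... | N , beyond = <-rec Descent descend (x + N * m)
    (beyond (x + N * m) (≤-trans (m≤m*n N m {{>-nonZero 0<m}}) (m≤n+m (N * m) x))) (N , inj₂ refl)
    where
    Descent : ℕ → Set
    Descent w = w ∈ S → CongMod m x w → ∃[ v ] (InApery S m v × CongMod m x v)

    descend : ∀ w → (∀ {v} → v < w → Descent v) → Descent w
    descend w ih w∈ x≡w with shifted? S m w
    ... | no unshifted = w , (w∈ , unshifted) , x≡w
    ... | yes (t , t∈ , refl) = ih (m<n+m t 0<m) t∈ (congMod-unshift x≡w)

  -- In a semigroup whose nonzero Apéry elements are all ≥ b, a nonzero Apéry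
  -- element y with y + z < 3b for some z ≥ b is a minimal generator: a
  -- splitting y = p + q would give 3b ≤ p + q + z.
  apery-generator : ∀ {m b y z} → (∀ w → InApery S m w → w ≢ 0 → b ≤ w) →
    InApery S m y → y ≢ 0 → b ≤ z → y + z < 3 * b → IsMinimalGenerator S y
  apery-generator {b = b} {z = z} above ap y≢0 b≤z small = proj₁ ap , y≢0 ,
    λ { (p , q , p∈ , q∈ , p≢0 , q≢0 , refl) → <⇒≱ small (begin
          3 * b        ≡⟨ solve 1 (λ b → con 3 :* b := b :+ b :+ b) refl b ⟩
          b + b + b    ≤⟨ +-mono-≤ (+-mono-≤ (above p (apery-summandˡ p∈ q∈ ap) p≢0)
                                              (above q (apery-summandʳ p∈ q∈ ap) q≢0)) b≤z ⟩
          p + q + z    ∎) }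
    where open ≤-Reasoning

module Splitting {S : ℕ → Bool} (NS : IsNumericalSemigroup S) {μ c a₂ : ℕ}
  (conductor : IsConductor S c)
  (generators-above : ∀ a → IsMinimalGenerator S a → a ≢ μ → a₂ ≤ a)
  (large : c + μ < 3 * a₂) where
  open ApérySet NS

  aperyAbove : ∀ w → InApery S μ w → w ≢ 0 → a₂ ≤ w
  aperyAbove = apery-lower-bound generators-above

  ordered-split : ∀ {a b} → a ≤ b → a ∈ S → b ∈ S → a ≢ 0 → b ≢ 0 →
    InApery S μ (a + b) → InP₁ S μ c a × (InP₁ S μ c b ⊎ InP₂ S μ c b)
  ordered-split {a} {b} a≤b a∈ b∈ a≢0 b≢0 ap = a∈P₁ , b∈P₁∪P₂ (c + μ ≤? 2 * b)
    where
    apa = apery-summandˡ a∈ b∈ ap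
    apb = apery-summandʳ a∈ b∈ ap
    a₂≤a = aperyAbove a apa a≢0
    a₂≤b = aperyAbove b apb b≢0

    sum<L : a + b < c + μ
    sum<L = apery-below-conductor conductor ap

    sum<3a₂ : a + b < 3 * a₂
    sum<3a₂ = <-trans sum<L large

    L<3a : c + μ < 3 * a
    L<3a = <-≤-trans large (*-monoʳ-≤ 3 a₂≤a)

    L<3b : c + μ < 3 * b
    L<3b = <-≤-trans large (*-monoʳ-≤ 3 a₂≤b)

    2a<L : 2 * a < c + μ
    2a<L = ≤-<-trans (+-monoʳ-≤ a (subst (_≤ b) (sym (+-identityʳ a)) a≤b)) sum<L

    -- 3b = 3(a + b) - 3a < 3L - L.
    3b<2L : 3 * b < 2 * (c + μ)
    3b<2L = +-cancelˡ-< (c + μ) (3 * b) (2 * (c + μ))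
      (<-trans (+-monoˡ-< (3 * b) L<3a)
               (subst (_< 3 * (c + μ)) (*-distribˡ-+ 3 a b) (*-monoʳ-< 3 sum<L)))

    a∈P₁ : InP₁ S μ c a
    a∈P₁ = apery-generator aperyAbove apa a≢0 a₂≤b sum<3a₂ , apery-≢ apa , L<3a , 2a<L

    b-generator : IsMinimalGenerator S b
    b-generator = apery-generator aperyAbove apb b≢0 a₂≤a (subst (_< 3 * a₂) (+-comm a b) sum<3a₂)

    b∈P₁∪P₂ : Dec (c + μ ≤ 2 * b) → InP₁ S μ c b ⊎ InP₂ S μ c b
    b∈P₁∪P₂ (yes L≤2b) = inj₂ (b-generator , apery-≢ apb , L≤2b , 3b<2L)
    b∈P₁∪P₂ (no L≰2b) = inj₁ (b-generator , apery-≢ apb , L<3b , ≰⇒> L≰2b)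

  apery-split : ∀ {w} → InApery S μ w → Decomposable S w →
    ∃[ a ] ∃[ b ] ((InP₁ S μ c a × (InP₁ S μ c b ⊎ InP₂ S μ c b)) × a + b ≡ w)
  apery-split ap (y , z , y∈ , z∈ , y≢0 , z≢0 , refl) with ≤-total y z
  ... | inj₁ y≤z = y , z , (ordered-split y≤z y∈ z∈ y≢0 z≢0 ap , refl)
  ... | inj₂ z≤y = z , y ,
    (ordered-split z≤y z∈ y∈ z≢0 y≢0 (subst (InApery S μ) (+-comm y z) ap) , +-comm z y)

proposition2p1 : (S : ℕ → Bool) → IsNumericalSemigroup S →
    (μ c a₂ : ℕ) → IsMultiplicity S μ → IsConductor S c →
    IsMinimalGenerator S a₂ → μ < a₂ →
    (∀ a → IsMinimalGenerator S a → a ≢ μ → a₂ ≤ a) →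
    c + μ < 3 * a₂ →
    (x : ℕ) →
      (∃[ a ] (IsMinimalGenerator S a × CongMod μ x a))
      ⊎ (∃[ a ] ∃[ b ] (InP₁ S μ c a × InP₁ S μ c b × CongMod μ x (a + b)))
      ⊎ (∃[ a ] ∃[ b ] (InP₁ S μ c a × InP₂ S μ c b × CongMod μ x (a + b)))
proposition2p1 S NS μ c a₂ multiplicity@(_ , μ≢0 , _) conductor _ _ generators-above large x
  with ApérySet.apery-representative NS (n≢0⇒n>0 μ≢0) x
... | w , ap , x≡w with w ≟ 0
...   | yes refl = inj₁ (μ , multiplicity-generator multiplicity ,
                         subst (CongMod μ x) (+-identityʳ μ) (congMod-shift x≡w))
...   | no w≢0 with generator-or-decomposable (proj₁ ap) w≢0
...     | inj₁ gen = inj₁ (w , gen , x≡w)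
...     | inj₂ dec with Splitting.apery-split NS conductor generators-above large ap dec
...       | a , b , (a∈P₁ , inj₁ b∈P₁) , refl = inj₂ (inj₁ (a , b , a∈P₁ , b∈P₁ , x≡w))
...       | a , b , (a∈P₁ , inj₂ b∈P₂) , refl = inj₂ (inj₂ (a , b , a∈P₁ , b∈P₂ , x≡w))
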